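{- Let $s,t_1,\dots,t_r$ be vertices in a directed graph $G$, let $k$ be a nonnegative integer, and let $F_1,\dots,F_r\subseteq E(G)$ be edge sets each of size at most $k$ such that for all $i,j\in[1,r]$ there is an $(s,t_j)$-path in $G-F_i$ if and only if $i=j$. Then $r\le 2^k$.
   Context: An $(s,t)$-path is a directed path from $s$ to $t$; $G-F$ is $G$ with the edges in $F$ removed. -}

module Defs where

open import Data.Nat using (ℕ)
open import Data.Fin using (Fin)
open import Data.Fin.Subset using (Subset; _∉_)
open import Data.List using (List; []; _∷_)
open import Data.List.Relation.Unary.Unique.Propositional using (Unique)
open import Data.Product using (Σ)
open import Relation.Binary.PropositionalEquality using (_≡_)

-- A finite directed graph (parallel edges and loops allowed):
-- vertices Fin nV, edges Fin nE, each edge e going from src e to tgt e.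
record Digraph : Set where
  field
    nV  : ℕ
    nE  : ℕ
    src : Fin nE → Fin nV
    tgt : Fin nE → Fin nV
open Digraph public

EdgeSet : Digraph → Set
EdgeSet G = Subset (nE G)

-- A directed walk from u to v in G - F (G with the edges of F removed):
-- a sequence of consecutive edges of G, none of which lies in F.
data Walk (G : Digraph) (F : EdgeSet G) : Fin (nV G) → Fin (nV G) → Set where
  []  : ∀ {u} → Walk G F u u
  _∷⟨_,_⟩_ : ∀ {u v} (e : Fin (nE G)) → e ∉ F → src G e ≡ u →
             Walk G F (tgt G e) v → Walk G F u v

vertices : ∀ {G F u v} → Walk G F u v → List (Fin (nV G))
vertices {u = u} []                 = u ∷ []
vertices {u = u} (e ∷⟨ _ , _ ⟩ w)   = u ∷ vertices w

Path : (G : Digraph) (F : EdgeSet G) → Fin (nV G) → Fin (nV G) → Set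
Path G F u v = Σ (Walk G F u v) λ w → Unique (vertices w)

{-# OPTIONS --safe #-}
module Submission where

-- A Kraft-type inequality.  Give a pair (t , C) of a target and a cut the weight
-- 2 ^ (k ∸ ∣ C ∣); any family of such pairs in which s reaches each target avoiding its
-- own cut, but no other target, has total weight at most 2 ^ k.  Induct on the number of
-- edges.  Let m be a pair with a largest cut and f the last edge of a walk from s to the
-- target of m avoiding its cut; every other cut separates s from that target.  Delete f
-- from G and from every cut.  If f lay in some other cut, drop m: the weight of that cut
-- doubles, which pays for m because its cut is no larger.  Otherwise move the target of m
-- back to the tail of f.  In both cases the other pairs still reach their targets, since
-- a walk through f would reach the target of m.

open import Defs
open import Data.Empty using (⊥-elim)
open import Data.Fin using (Fin; _≟_)
open import Data.Fin.Subset using (Subset; _∈_; _∉_; _⊆_; _∪_; ∁; ⊥; ⁅_⁆; _-_; ∣_∣)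
open import Data.Fin.Subset.Properties
  using (x∈p∪q⁻; x∈p∪q⁺; p⊆p∪q; x∈⁅x⁆; x≢y⇒x∉⁅y⁆; x∈p∧x≢y⇒x∈p-y; p─q⊆p; ∣p─q∣≤∣p∣;
         p⊂q⇒∣p∣<∣q∣; p⊂q⇒∁p⊃∁q; x∈p⇒∣p-x∣<∣p∣; _∈?_; ∪-identityˡ)
open import Data.List using (List; []; _∷_; map; length; tabulate)
open import Data.List.Properties using (length-tabulate; map-∘)
open import Data.List.Membership.Propositional using () renaming (_∈_ to _∈ˡ_)
import Data.List.Membership.DecPropositional as DecMembership
open import Data.List.Relation.Binary.Permutation.Propositional
  using (_↭_; prep; swap; ↭-refl; ↭-trans; ↭⇒↭ₛ)
import Data.List.Relation.Binary.Permutation.Propositional.Properties as ↭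
import Data.List.Relation.Binary.Permutation.Setoid.Properties as ↭ₛ
open import Data.List.Relation.Unary.All as All using (All; []; _∷_)
import Data.List.Relation.Unary.All.Properties as All
open import Data.List.Relation.Unary.AllPairs as AllPairs using (AllPairs; []; _∷_)
import Data.List.Relation.Unary.AllPairs.Properties as AllPairs
open import Data.List.Relation.Unary.Any using (Any; here; there; any?)
open import Data.List.Relation.Unary.Unique.Propositional using (Unique)
open import Data.Nat using (ℕ; suc; _+_; _∸_; _^_; _≤_; _<_; z≤n; _≤?_)
open import Data.Nat.Induction using (<-wellFounded)
open import Data.Nat.ListAction using (sum)
open import Data.Nat.ListAction.Properties using (sum-↭)
open import Data.Nat.Properties hiding (_≟_)
open import Algebra.Properties.CommutativeSemigroup +-commutativeSemigroup using (x∙yz≈y∙xz)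
open import Data.Product as Product using (∃-syntax; ∃₂; _×_; _,_; proj₁; proj₂)
open import Data.Sum as Sum using (_⊎_; inj₁; inj₂; [_,_])
open import Function using (_∘_; id; _⇔_; Equivalence)
open import Induction.WellFounded using (Acc; acc)
open import Relation.Binary.PropositionalEquality using (_≡_; refl; sym; cong; subst; resp₂; setoid)
open import Relation.Nullary using (¬_; yes; no)

x∉p∧x∉q⇒x∉p∪q : ∀ {n} {p q : Subset n} {x} → x ∉ p → x ∉ q → x ∉ p ∪ q
x∉p∧x∉q⇒x∉p∪q {p = p} {q} x∉p x∉q = [ x∉p , x∉q ] ∘ x∈p∪q⁻ p q

p∪q⊆[p∪⁅x⁆]∪[q-x] : ∀ {n} (p q : Subset n) x → p ∪ q ⊆ (p ∪ ⁅ x ⁆) ∪ (q - x)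
p∪q⊆[p∪⁅x⁆]∪[q-x] p q x {y} y∈p∪q with x∈p∪q⁻ p q y∈p∪q | y ≟ x
... | inj₁ y∈p | _        = x∈p∪q⁺ (inj₁ (x∈p∪q⁺ (inj₁ y∈p)))
... | inj₂ _   | yes refl = x∈p∪q⁺ (inj₁ (x∈p∪q⁺ (inj₂ (x∈⁅x⁆ x))))
... | inj₂ y∈q | no y≢x   = x∈p∪q⁺ (inj₂ (x∈p∧x≢y⇒x∈p-y y∈q y≢x))

[p∪⁅x⁆]∪[q-x]⊆[p∪q]∪⁅x⁆ : ∀ {n} (p q : Subset n) x → (p ∪ ⁅ x ⁆) ∪ (q - x) ⊆ (p ∪ q) ∪ ⁅ x ⁆
[p∪⁅x⁆]∪[q-x]⊆[p∪q]∪⁅x⁆ p q x y∈ with x∈p∪q⁻ (p ∪ ⁅ x ⁆) (q - x) y∈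
... | inj₂ y∈q-x = x∈p∪q⁺ (inj₁ (x∈p∪q⁺ (inj₂ (p─q⊆p q ⁅ x ⁆ y∈q-x))))
... | inj₁ y∈p∪x with x∈p∪q⁻ p ⁅ x ⁆ y∈p∪x
...   | inj₁ y∈p   = x∈p∪q⁺ (inj₁ (x∈p∪q⁺ (inj₁ y∈p)))
...   | inj₂ y∈⁅x⁆ = x∈p∪q⁺ (inj₂ y∈⁅x⁆)

x∉p⇒∣∁[p∪⁅x⁆]∣<∣∁p∣ : ∀ {n} {p : Subset n} {x} → x ∉ p → ∣ ∁ (p ∪ ⁅ x ⁆) ∣ < ∣ ∁ p ∣
x∉p⇒∣∁[p∪⁅x⁆]∣<∣∁p∣ {x = x} x∉p =
  p⊂q⇒∣p∣<∣q∣ (p⊂q⇒∁p⊃∁q (p⊆p∪q ⁅ x ⁆ , x , x∈p∪q⁺ (inj₂ (x∈⁅x⁆ x)) , x∉p))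

module _ {a} {A : Set a} where

  selectMax : (f : A → ℕ) (x : A) (xs : List A) →
              ∃₂ λ m rest → x ∷ xs ↭ m ∷ rest × All (λ z → f z ≤ f m) rest
  selectMax f x [] = x , [] , ↭-refl , []
  selectMax f x (y ∷ ys) with selectMax f y ys
  ... | m , rest , y∷ys↭m∷rest , rest≤m with f x ≤? f m
  ...   | yes x≤m = m , x ∷ rest , ↭-trans (prep x y∷ys↭m∷rest) (swap x m ↭-refl) , x≤m ∷ rest≤m
  ...   | no x≰m  = x , m ∷ rest , prep x y∷ys↭m∷rest , m≤x ∷ All.map (λ z≤m → ≤-trans z≤m m≤x) rest≤m
    where m≤x = <⇒≤ (≰⇒> x≰m)

  sum-map-≤ : ∀ {f g : A → ℕ} → (∀ x → f x ≤ g x) → ∀ xs → sum (map f xs) ≤ sum (map g xs)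
  sum-map-≤ f≤g []       = z≤n
  sum-map-≤ f≤g (x ∷ xs) = +-mono-≤ (f≤g x) (sum-map-≤ f≤g xs)

  +-sum-map-≤ : ∀ {f g : A → ℕ} {P : A → Set} {c xs} → (∀ x → f x ≤ g x) →
                All (λ x → P x → c + f x ≤ g x) xs → Any P xs → c + sum (map f xs) ≤ sum (map g xs)
  +-sum-map-≤ {f} {g} {c = c} {x ∷ xs} f≤g (c+fx≤gx ∷ _) (here px) = begin
    c + (f x + sum (map f xs))  ≡⟨ +-assoc c (f x) _ ⟨
    c + f x + sum (map f xs)    ≤⟨ +-mono-≤ (c+fx≤gx px) (sum-map-≤ f≤g xs) ⟩
    g x + sum (map g xs)        ∎
    where open ≤-Reasoning
  +-sum-map-≤ {f} {g} {c = c} {x ∷ xs} f≤g (_ ∷ hs) (there pxs) = begin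
    c + (f x + sum (map f xs))  ≡⟨ x∙yz≈y∙xz c (f x) _ ⟩
    f x + (c + sum (map f xs))  ≤⟨ +-mono-≤ (f≤g x) (+-sum-map-≤ f≤g hs pxs) ⟩
    g x + sum (map g xs)        ∎
    where open ≤-Reasoning

2^[k∸b]+2^[k∸b]≤2^[k∸a] : ∀ {a b} k → a < b → b ≤ k → 2 ^ (k ∸ b) + 2 ^ (k ∸ b) ≤ 2 ^ (k ∸ a)
2^[k∸b]+2^[k∸b]≤2^[k∸a] {a} {b} k a<b b≤k = begin
  2 ^ (k ∸ b) + 2 ^ (k ∸ b)  ≡⟨ cong (2 ^ (k ∸ b) +_) (+-identityʳ _) ⟨
  2 ^ suc (k ∸ b)            ≡⟨ cong (2 ^_) (+-∸-assoc 1 b≤k) ⟨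
  2 ^ (suc k ∸ b)            ≤⟨ ^-monoʳ-≤ 2 (∸-monoʳ-≤ (suc k) a<b) ⟩
  2 ^ (k ∸ a)                ∎
  where open ≤-Reasoning

module _ {G : Digraph} {F : EdgeSet G} where

  weaken : ∀ {F′ u v} → F′ ⊆ F → Walk G F u v → Walk G F′ u v
  weaken F′⊆F []                   = []
  weaken F′⊆F (e ∷⟨ e∉F , e↦u ⟩ w) = e ∷⟨ e∉F ∘ F′⊆F , e↦u ⟩ weaken F′⊆F w

  snoc : ∀ {u} e → Walk G F u (src G e) → e ∉ F → Walk G F u (tgt G e)
  snoc e []                      e∉F = e ∷⟨ e∉F , refl ⟩ []
  snoc e (e′ ∷⟨ e′∉F , e′↦u ⟩ w) e∉F = e′ ∷⟨ e′∉F , e′↦u ⟩ snoc e w e∉F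

  lastEdge : ∀ {u v} → Walk G F u v → u ≡ v ⊎ ∃[ e ] (Walk G F u (src G e) × e ∉ F × tgt G e ≡ v)
  lastEdge [] = inj₁ refl
  lastEdge (e ∷⟨ e∉F , refl ⟩ w) with lastEdge w
  ... | inj₁ refl                  = inj₂ (e , [] , e∉F , refl)
  ... | inj₂ (e′ , w′ , e′∉F , e′↦v) = inj₂ (e′ , e ∷⟨ e∉F , refl ⟩ w′ , e′∉F , e′↦v)

  avoid : ∀ {u v} f → Walk G F u v →
          Walk G (F ∪ ⁅ f ⁆) u v ⊎ (Walk G (F ∪ ⁅ f ⁆) u (src G f) × f ∉ F)
  avoid f [] = inj₁ []
  avoid f (e ∷⟨ e∉F , refl ⟩ w) with e ≟ f
  ... | yes refl = inj₂ ([] , e∉F)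
  ... | no e≢f   = Sum.map (e ∷⟨ e∉F∪f , refl ⟩_) (Product.map₁ (e ∷⟨ e∉F∪f , refl ⟩_)) (avoid f w)
    where e∉F∪f = x∉p∧x∉q⇒x∉p∪q e∉F (x≢y⇒x∉⁅y⁆ e≢f)

  open DecMembership (_≟_ {nV G}) using () renaming (_∈?_ to _∈ˡ?_)

  suffix : ∀ {u v x} (w : Walk G F u v) → Unique (vertices w) → x ∈ˡ vertices w → Path G F x v
  suffix []                   !w       (here refl) = [] , !w
  suffix w@(_ ∷⟨ _ , _ ⟩ _)   !w       (here refl) = w , !w
  suffix (_ ∷⟨ _ , _ ⟩ w)     (_ ∷ !w) (there x∈w) = suffix w !w x∈w

  toPath : ∀ {u v} → Walk G F u v → Path G F u v
  toPath [] = [] , [] ∷ []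
  toPath {u} (e ∷⟨ e∉F , e↦u ⟩ w) with toPath w
  ... | w′ , !w′ with u ∈ˡ? vertices w′
  ...   | yes u∈w′ = suffix w′ !w′ u∈w′
  ...   | no u∉w′  = e ∷⟨ e∉F , e↦u ⟩ w′ , All.¬Any⇒All¬ (vertices w′) u∉w′ ∷ !w′

module Kraft (G : Digraph) (s : Fin (nV G)) (k : ℕ) where

  record Item : Set where
    constructor _,_
    field
      target : Fin (nV G)
      cut    : EdgeSet G
  open Item

  -- D is the set of edges deleted from G so far.
  Reach : EdgeSet G → EdgeSet G → Fin (nV G) → Set
  Reach D C t = Walk G (D ∪ C) s t

  Separates : EdgeSet G → Item → Item → Set
  Separates D x y = ¬ Reach D (cut x) (target y)

  Apart : EdgeSet G → Item → Item → Set
  Apart D x y = Separates D x y × Separates D y x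

  record Separating (D : EdgeSet G) (xs : List Item) : Set where
    field
      bounded : All (λ x → ∣ cut x ∣ ≤ k) xs
      reached : All (λ x → Reach D (cut x) (target x)) xs
      apart   : AllPairs (Apart D) xs
  open Separating

  Separating-↭ : ∀ {D xs ys} → xs ↭ ys → Separating D xs → Separating D ys
  Separating-↭ {D} xs↭ys sep = record
    { bounded = ↭.All-resp-↭ xs↭ys (bounded sep)
    ; reached = ↭.All-resp-↭ xs↭ys (reached sep)
    ; apart   = ↭ₛ.AllPairs-resp-↭ (setoid Item) Product.swap (resp₂ (Apart D)) (↭⇒↭ₛ xs↭ys) (apart sep)
    }

  Separating-tail : ∀ {D x xs} → Separating D (x ∷ xs) → Separating D xs
  Separating-tail sep = record
    { bounded = All.tail (bounded sep)
    ; reached = All.tail (reached sep)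
    ; apart   = AllPairs.tail (apart sep)
    }

  weight : Item → ℕ
  weight x = 2 ^ (k ∸ ∣ cut x ∣)

  total : List Item → ℕ
  total xs = sum (map weight xs)

  total-↭ : ∀ {xs ys} → xs ↭ ys → total xs ≡ total ys
  total-↭ xs↭ys = sum-↭ (↭.map⁺ weight xs↭ys)

  total-map : ∀ (h : Item → Item) xs → total (map h xs) ≡ sum (map (weight ∘ h) xs)
  total-map h xs = cong sum (sym (map-∘ xs))

  weight≤2^k : ∀ x → weight x ≤ 2 ^ k
  weight≤2^k x = ^-monoʳ-≤ 2 (m∸n≤m k ∣ cut x ∣)

  length≤total : ∀ xs → length xs ≤ total xs
  length≤total []       = z≤n
  length≤total (x ∷ xs) = +-mono-≤ (m^n>0 2 (k ∸ ∣ cut x ∣)) (length≤total xs)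

  dropEdge : Fin (nE G) → Item → Item
  dropEdge f x = target x , cut x - f

  weight≤weight-dropEdge : ∀ f x → weight x ≤ weight (dropEdge f x)
  weight≤weight-dropEdge f x = ^-monoʳ-≤ 2 (∸-monoʳ-≤ k (∣p─q∣≤∣p∣ (cut x) ⁅ f ⁆))

  weight+weight≤weight-dropEdge : ∀ {f x y} → ∣ cut y ∣ ≤ ∣ cut x ∣ → ∣ cut y ∣ ≤ k → f ∈ cut y →
                                   weight x + weight y ≤ weight (dropEdge f y)
  weight+weight≤weight-dropEdge {f} {x} {y} y≤x y≤k f∈y = ≤-trans
    (+-monoˡ-≤ (weight y) (^-monoʳ-≤ 2 (∸-monoʳ-≤ k y≤x)))
    (2^[k∸b]+2^[k∸b]≤2^[k∸a] k (x∈p⇒∣p-x∣<∣p∣ f∈y) y≤k)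

  module DeleteEdge {D : EdgeSet G} (f : Fin (nE G)) where

    D′ : EdgeSet G
    D′ = D ∪ ⁅ f ⁆

    unreach-dropEdge : ∀ {C t} → ¬ Reach D C t → ¬ Reach D′ (C - f) t
    unreach-dropEdge {C} ¬r = ¬r ∘ weaken (p∪q⊆[p∪⁅x⁆]∪[q-x] D C f)

    reach-dropEdge-src : ∀ {C} → Reach D C (src G f) → Reach D′ (C - f) (src G f)
    reach-dropEdge-src {C} r = weaken ([p∪⁅x⁆]∪[q-x]⊆[p∪q]∪⁅x⁆ D C f) ([ id , proj₁ ] (avoid f r))

    -- A walk through f would reach tgt G f.
    reach-dropEdge : ∀ {C t} → ¬ Reach D C (tgt G f) → Reach D C t → Reach D′ (C - f) t
    reach-dropEdge {C} ¬r r with avoid f r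
    ... | inj₁ r′          = weaken ([p∪⁅x⁆]∪[q-x]⊆[p∪q]∪⁅x⁆ D C f) r′
    ... | inj₂ (r′ , f∉DC) = ⊥-elim (¬r (snoc f (weaken (p⊆p∪q ⁅ f ⁆) r′) f∉DC))

    unreach-dropEdge-src : ∀ {C} → f ∉ D ∪ C → ¬ Reach D C (tgt G f) → ¬ Reach D′ (C - f) (src G f)
    unreach-dropEdge-src {C} f∉DC ¬r r = ¬r (snoc f (weaken (p∪q⊆[p∪⁅x⁆]∪[q-x] D C f) r) f∉DC)

    Separating-dropEdge : ∀ {xs} → Separating D xs → All (λ x → ¬ Reach D (cut x) (tgt G f)) xs →
                          Separating D′ (map (dropEdge f) xs)
    Separating-dropEdge sep cutOff = record
      { bounded = All.map⁺ (All.map (λ {x} → ≤-trans (∣p─q∣≤∣p∣ (cut x) ⁅ f ⁆)) (bounded sep))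
      ; reached = All.map⁺ (All.zipWith (λ (r , ¬r) → reach-dropEdge ¬r r) (reached sep , cutOff))
      ; apart   = AllPairs.map⁺ (AllPairs.map (Product.map unreach-dropEdge unreach-dropEdge) (apart sep))
      }

  record Reduction (D : EdgeSet G) (xs : List Item) : Set where
    field
      {D′}       : EdgeSet G
      ys         : List Item
      fewer      : ∣ ∁ D′ ∣ < ∣ ∁ D ∣
      heavier    : total xs ≤ total ys
      separating : Separating D′ ys

  module _ {D m rest} (sep : Separating D (m ∷ rest))
           {f} (f∉D∪m : f ∉ D ∪ cut m) (f↦m : tgt G f ≡ target m) where

    open DeleteEdge {D} f

    private
      f∉D : f ∉ D
      f∉D = f∉D∪m ∘ x∈p∪q⁺ ∘ inj₁

      cutOff : All (λ x → ¬ Reach D (cut x) (tgt G f)) rest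
      cutOff = All.map (λ (_ , ¬r) → ¬r ∘ subst (Reach D _) f↦m) (AllPairs.head (apart sep))

      rest′ : Separating D′ (map (dropEdge f) rest)
      rest′ = Separating-dropEdge (Separating-tail sep) cutOff

    reduceByDropping : All (λ z → ∣ cut z ∣ ≤ ∣ cut m ∣) rest → Any (λ z → f ∈ cut z) rest →
                       Reduction D (m ∷ rest)
    reduceByDropping maximal hit = record
      { ys         = map (dropEdge f) rest
      ; fewer      = x∉p⇒∣∁[p∪⁅x⁆]∣<∣∁p∣ f∉D
      ; heavier    = ≤-trans
          (+-sum-map-≤ (weight≤weight-dropEdge f)
                       (All.zipWith (λ {z} (z≤m , z≤k) → weight+weight≤weight-dropEdge {f} {m} {z} z≤m z≤k)
                                    (maximal , All.tail (bounded sep)))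
                       hit)
          (≤-reflexive (sym (total-map (dropEdge f) rest)))
      ; separating = rest′
      }

    reduceByRetargeting : Reach D (cut m) (src G f) → All (λ z → f ∉ cut z) rest →
                          Reduction D (m ∷ rest)
    reduceByRetargeting r miss = record
      { ys         = (src G f , cut m - f) ∷ map (dropEdge f) rest
      ; fewer      = x∉p⇒∣∁[p∪⁅x⁆]∣<∣∁p∣ f∉D
      ; heavier    = +-mono-≤ (weight≤weight-dropEdge f m)
          (≤-trans (sum-map-≤ (weight≤weight-dropEdge f) rest)
                   (≤-reflexive (sym (total-map (dropEdge f) rest))))
      ; separating = record
        { bounded = ≤-trans (∣p─q∣≤∣p∣ (cut m) ⁅ f ⁆) (All.head (bounded sep)) ∷ bounded rest′
        ; reached = reach-dropEdge-src r ∷ reached rest′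
        ; apart   = All.map⁺ (All.zipWith apart-retargeted
                                          (AllPairs.head (apart sep) , All.zip (miss , cutOff)))
                    ∷ apart rest′
        }
      }
      where
        apart-retargeted : ∀ {z} → Apart D m z × (f ∉ cut z × ¬ Reach D (cut z) (tgt G f)) →
                           Apart D′ (src G f , cut m - f) (dropEdge f z)
        apart-retargeted ((m⊬z , _) , (f∉z , z⊬f)) =
          unreach-dropEdge m⊬z , unreach-dropEdge-src (x∉p∧x∉q⇒x∉p∪q f∉D f∉z) z⊬f

  reduce : ∀ {D m y zs} → Separating D (m ∷ y ∷ zs) → All (λ z → ∣ cut z ∣ ≤ ∣ cut m ∣) (y ∷ zs) →
           Reduction D (m ∷ y ∷ zs)
  reduce {D} {m} {y} {zs} sep maximal with lastEdge (All.head (reached sep))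
  ... | inj₁ s≡m =
    ⊥-elim (proj₂ (All.head (AllPairs.head (apart sep))) (subst (Reach D (cut y)) s≡m []))
  ... | inj₂ (f , r , f∉D∪m , f↦m) with any? (λ z → f ∈? cut z) (y ∷ zs)
  ...   | yes hit = reduceByDropping sep f∉D∪m f↦m maximal hit
  ...   | no miss = reduceByRetargeting sep f∉D∪m f↦m r (All.¬Any⇒All¬ (y ∷ zs) miss)

  total≤2^k : ∀ {D} xs → Separating D xs → Acc _<_ ∣ ∁ D ∣ → total xs ≤ 2 ^ k
  total≤2^k []       _   _         = z≤n
  total≤2^k (x ∷ xs) sep (acc rec) with selectMax (∣_∣ ∘ cut) x xs
  ... | m , [] , x∷xs↭m , _ = begin
    total (x ∷ xs)  ≡⟨ total-↭ x∷xs↭m ⟩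
    weight m + 0    ≡⟨ +-identityʳ (weight m) ⟩
    weight m        ≤⟨ weight≤2^k m ⟩
    2 ^ k           ∎
    where open ≤-Reasoning
  ... | m , y ∷ zs , x∷xs↭m∷y∷zs , maximal = begin
    total (x ∷ xs)      ≡⟨ total-↭ x∷xs↭m∷y∷zs ⟩
    total (m ∷ y ∷ zs)  ≤⟨ heavier ⟩
    total ys            ≤⟨ total≤2^k ys separating (rec fewer) ⟩
    2 ^ k               ∎
    where
      open ≤-Reasoning
      open Reduction (reduce (Separating-↭ x∷xs↭m∷y∷zs sep) maximal)

  Separating-tabulate : ∀ {r} (t : Fin r → Fin (nV G)) (F : Fin r → EdgeSet G) →
                        (∀ i → ∣ F i ∣ ≤ k) → (∀ i j → Path G (F i) s (t j) ⇔ i ≡ j) →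
                        Separating ⊥ (tabulate λ i → t i , F i)
  Separating-tabulate t F ∣F∣≤k path⇔≡ = record
    { bounded = All.tabulate⁺ ∣F∣≤k
    ; reached = All.tabulate⁺ λ i → subst (λ X → Walk G X s (t i)) (sym (∪-identityˡ (F i)))
                                          (proj₁ (Equivalence.from (path⇔≡ i i) refl))
    ; apart   = AllPairs.tabulate⁺ λ {i} {j} i≢j →
        (λ w → i≢j (Equivalence.to (path⇔≡ i j) (toPath′ w))) ,
        (λ w → i≢j (sym (Equivalence.to (path⇔≡ j i) (toPath′ w))))
    }
    where
      toPath′ : ∀ {i v} → Reach ⊥ (F i) v → Path G (F i) s v
      toPath′ {i} = toPath ∘ subst (λ X → Walk G X s _) (∪-identityˡ (F i))

lemma2p3 : (G : Digraph) (r k : ℕ) (s : Fin (nV G)) (t : Fin r → Fin (nV G))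
           (F : Fin r → EdgeSet G) →
           (∀ i → ∣ F i ∣ ≤ k) →
           (∀ i j → (Path G (F i) s (t j) ⇔ (i ≡ j))) →
           r ≤ 2 ^ k
lemma2p3 G r k s t F ∣F∣≤k path⇔≡ = begin
  r             ≡⟨ length-tabulate item ⟨
  length items  ≤⟨ length≤total items ⟩
  total items   ≤⟨ total≤2^k items (Separating-tabulate t F ∣F∣≤k path⇔≡) (<-wellFounded _) ⟩
  2 ^ k         ∎
  where
    open ≤-Reasoning
    open Kraft G s k

    item : Fin r → Item
    item i = t i , F i

    items : List Item
    items = tabulate item
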